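{- Let $m \geq 2$ and $k \geq 2$ be integers, and let $T$ be a perfect $m$-ary tree of depth $d$ with $k \leq d \leq \frac{3k}{2}$. Then $\gamma_{all,k}^\infty(T) = 1+m^{d-k}$.
   Context: A perfect $m$-ary tree of depth $d$ is a rooted tree in which every non-leaf vertex has exactly $m$ children and every leaf is at distance exactly $d$ from the root. Graphs are finite and simple; $d(u,v)$ is graph distance and $N_k[x]=\{v: d(x,v)\le k\}$. A multiset $D$ of vertices of $G$ is a distance-$k$ dominating set if every vertex of $V(G)\setminus D$ is at distance at most $k$ from some element of $D$. Let $\mathbb{D}_{k,q}(G)$ be the set of such multisets of cardinality $q$. $D=\{v_1,\dots,v_q\}$ transforms to $D'=\{u_1,\dots,u_q\}$ if (for some indexing) $u_i\in N_k[v_i]$ for all $i$. An eternal distance-$k$ dominating family is $\mathcal{E}\subseteq\mathbb{D}_{k,q}(G)$ for some $q$ such that for every $D\in\mathcal{E}$ and every vertex $v$ there is $D'\in\mathcal{E}$ with $v\in D'$ and $D$ transforms to $D'$. $\gamma_{all,k}^\infty(G)$ is the minimum $q$ for which such a family exists. -}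

module Defs where

open import Level using (0ℓ)
open import Data.Nat using (ℕ; zero; suc; _≤_)
open import Data.Fin using (Fin)
open import Data.List using (List; []; _∷_; length)
open import Data.Product using (Σ; ∃; _×_; _,_; proj₁)
open import Data.Sum using (_⊎_)
open import Data.Vec.Functional using (Vector)
open import Function.Bundles using (_↔_; Inverse)
open import Relation.Binary.PropositionalEquality using (_≡_)

record Graph : Set₁ where
  field
    V   : Set
    Adj : V → V → Set

open Graph public

data Walk (G : Graph) : V G → V G → ℕ → Set where
  nil  : ∀ {u} → Walk G u u zero
  cons : ∀ {u w v n} → Adj G u w → Walk G w v n → Walk G u v (suc n)

InNbhd : (G : Graph) → ℕ → V G → V G → Set
InNbhd G k u v = ∃ λ n → n ≤ k × Walk G u v n

-- A multiset of q vertices, represented as a q-tuple (taken up to reordering).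
Multiset : Graph → ℕ → Set
Multiset G q = Vector (V G) q

_∈ₘ_ : {G : Graph} {q : ℕ} → V G → Multiset G q → Set
v ∈ₘ D = ∃ λ i → D i ≡ v

IsDistDomSet : (G : Graph) (k : ℕ) {q : ℕ} → Multiset G q → Set
IsDistDomSet G k {q} D =
  (v : V G) → _∈ₘ_ {G} v D ⊎ (∃ λ i → InNbhd G k (D i) v)

Transforms : (G : Graph) (k : ℕ) {q : ℕ} → Multiset G q → Multiset G q → Set
Transforms G k {q} D D' =
  Σ (Fin q ↔ Fin q) λ σ → (i : Fin q) → InNbhd G k (D i) (D' (Inverse.to σ i))

record EternalFamily (G : Graph) (k q : ℕ) : Set₁ where
  field
    member    : Multiset G q → Set
    nonempty  : ∃ λ D → member D
    dominates : ∀ D → member D → IsDistDomSet G k D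
    respond   : ∀ D → member D → (v : V G) →
                ∃ λ D' → member D' × _∈ₘ_ {G} v D' × Transforms G k D D'

EternalDomNumberIs : (G : Graph) (k g : ℕ) → Set₁
EternalDomNumberIs G k g =
  EternalFamily G k g × ((q : ℕ) → EternalFamily G k q → g ≤ q)

-- Perfect m-ary tree of depth d: vertices are addresses (child indices from the
-- vertex up to the root) of length ≤ d; the root is [], the children of u are i ∷ u.
TreeVertex : ℕ → ℕ → Set
TreeVertex m d = Σ (List (Fin m)) λ l → length l ≤ d

ChildOf : {m d : ℕ} → TreeVertex m d → TreeVertex m d → Set
ChildOf {m} v u = ∃ λ (i : Fin m) → proj₁ v ≡ i ∷ proj₁ u

PerfectTree : ℕ → ℕ → Graph
PerfectTree m d = record
  { V   = TreeVertex m d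
  ; Adj = λ u v → ChildOf v u ⊎ ChildOf u v
  }

{-# OPTIONS --safe #-}
module Submission where

-- Put n = d − k, so 2n ≤ k. Every vertex is within k of a vertex at depth n, and any two
-- depth-n vertices are within 2n ≤ k of each other. Hence 1 + m^n guards suffice: one on each
-- depth-n vertex plus a free guard. To defend v, the free guard steps onto a depth-n vertex a,
-- the guard at a moves to a depth-n vertex b near v, and the guard at b moves onto v and
-- becomes the new free guard.
-- Conversely, some configuration of any family has a guard on the leaf 0…0. Below each
-- depth-n vertex y pick the leaf reached through child 1 followed by children 0. These m^n
-- leaves are farther than k from 0…0, and no vertex is within k of two of them (their paths
-- split above depth n), so m^n further guards are needed.

open import Data.Fin as Fin using (Fin; zero; suc; combine; remQuot)
import Data.Fin.Properties as Fin
open import Data.List using (List; []; _∷_; length; _++_; drop; replicate)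
open import Data.List.Properties
  using ( ∷-injective; ∷-injectiveʳ; ++-assoc; length-++; length-drop; length-replicate
        ; drop-all; ≡-dec)
open import Data.Nat using (ℕ; zero; suc; _≤_; _<_; _+_; _*_; _∸_; _^_; z≤n; s≤s; _≤?_)
open import Data.Nat.Properties
open import Data.Nat.Tactic.RingSolver using (solve-∀)
open import Data.Product using (∃; _×_; _,_; proj₁; proj₂; uncurry)
open import Data.Sum using (inj₁; inj₂)
open import Data.Vec.Functional using (Vector; updateAt)
open import Data.Vec.Functional.Properties using (updateAt-updates; updateAt-minimal)
open import Defs
open import Function.Base using (const; _∘_)
open import Function.Construct.Identity using (↔-id)
open import Function.Definitions using (Injective)
open import Relation.Binary.Definitions using (Symmetric; DecidableEquality)
open import Relation.Binary.PropositionalEquality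
open import Relation.Nullary using (¬_; yes; no)

excess-double-≤ : ∀ k d → k ≤ d → 2 * d ≤ 3 * k → (d ∸ k) + (d ∸ k) ≤ k
excess-double-≤ k d k≤d 2d≤3k =
  +-cancelʳ-≤ (k + k) (n + n) k (subst₂ _≤_ (2[n+k]≡ n k) (3k≡ k) 2[n+k]≤3k)
  where
  n : ℕ
  n = d ∸ k
  2[n+k]≤3k : 2 * (n + k) ≤ 3 * k
  2[n+k]≤3k = subst (λ e → 2 * e ≤ 3 * k) (sym (m∸n+n≡m k≤d)) 2d≤3k
  2[n+k]≡ : ∀ n k → 2 * (n + k) ≡ (n + n) + (k + k)
  2[n+k]≡ = solve-∀
  3k≡ : ∀ k → 3 * k ≡ k + (k + k)
  3k≡ = solve-∀

half-≤ : ∀ a k → a + a ≤ suc k → a ≤ k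
half-≤ zero    k _         = z≤n
half-≤ (suc a) k (s≤s 2a≤k) = ≤-trans (m≤n+m (suc a) a) 2a≤k

injective-avoiding⇒< : ∀ {a r} (f : Fin a → Fin r) (j : Fin r) →
  (∀ x → j ≢ f x) → Injective _≡_ _≡_ f → a < r
injective-avoiding⇒< {r = suc r} f j j∉f f-inj =
  s≤s (Fin.injective⇒≤ λ eq → f-inj (Fin.punchOut-injective (j∉f _) (j∉f _) eq))

module _ {G : Graph} where

  _++ʷ_ : ∀ {u v w a b} → Walk G u v a → Walk G v w b → Walk G u w (a + b)
  nil      ++ʷ q = q
  cons e p ++ʷ q = cons e (p ++ʷ q)

  reverseʷ : Symmetric (Adj G) → ∀ {u v a} → Walk G u v a → Walk G v u a
  reverseʷ sym nil = nil
  reverseʷ sym {u} {v} (cons {n = a} e p) =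
    subst (Walk G v u) (+-comm a 1) (reverseʷ sym p ++ʷ cons (sym e) nil)

  InNbhd-reflexive : ∀ {k u v} → u ≡ v → InNbhd G k u v
  InNbhd-reflexive refl = 0 , z≤n , nil

  InNbhd-sym : Symmetric (Adj G) → ∀ {k u v} → InNbhd G k u v → InNbhd G k v u
  InNbhd-sym sym (a , a≤k , p) = a , a≤k , reverseʷ sym p

  InNbhd-trans : ∀ {a b u v w} → InNbhd G a u v → InNbhd G b v w → InNbhd G (a + b) u w
  InNbhd-trans (x , x≤a , p) (y , y≤b , q) = x + y , +-mono-≤ x≤a y≤b , p ++ʷ q

  InNbhd-mono : ∀ {a b u v} → a ≤ b → InNbhd G a u v → InNbhd G b u v
  InNbhd-mono a≤b (x , x≤a , p) = x , ≤-trans x≤a a≤b , p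

module _ {A : Set} where

  -- With addresses read upwards, p ++ s lies length p levels below s.
  ViaCommonAncestor : ℕ → List A → List A → Set
  ViaCommonAncestor t xs ys = ∃ λ ((p , p′ , s) : List A × List A × List A) →
    xs ≡ p ++ s × ys ≡ p′ ++ s × length p + length p′ ≤ t

  ViaCommonAncestor-mono : ∀ {a b xs ys} → a ≤ b →
                           ViaCommonAncestor a xs ys → ViaCommonAncestor b xs ys
  ViaCommonAncestor-mono a≤b (ps , xs≡ , ys≡ , ≤a) = ps , xs≡ , ys≡ , ≤-trans ≤a a≤b

  ++-≡-++⇒suffix : ∀ a b {c s : List A} → a ++ s ≡ b ++ c → length a ≤ length b → ∃ λ r → s ≡ r ++ c
  ++-≡-++⇒suffix []      b       eq _         = b , eq
  ++-≡-++⇒suffix (_ ∷ a) (_ ∷ b) eq (s≤s a≤b) = ++-≡-++⇒suffix a b (∷-injectiveʳ eq) a≤b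

  ++-cancelˡ-length : ∀ a b {e e′ : List A} → length e ≡ length e′ → a ++ e ≡ b ++ e′ → e ≡ e′
  ++-cancelˡ-length a b {e} {e′} |e|≡|e′| eq = go a b |a|≡|b| eq
    where
    go : ∀ a b → length a ≡ length b → a ++ e ≡ b ++ e′ → e ≡ e′
    go []      []      _ eq = eq
    go (_ ∷ a) (_ ∷ b) l eq = go a b (suc-injective l) (∷-injectiveʳ eq)
    |a|≡|b| : length a ≡ length b
    |a|≡|b| = +-cancelʳ-≡ (length e) (length a) (length b) (begin
      length a + length e  ≡⟨ length-++ a ⟨
      length (a ++ e)      ≡⟨ cong length eq ⟩
      length (b ++ e′)     ≡⟨ length-++ b ⟩
      length b + length e′ ≡⟨ cong (length b +_) |e|≡|e′| ⟨
      length b + length e  ∎)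
      where open ≡-Reasoning

  replicate≢++∷ : ∀ {x y : A} t r c → x ≢ y → replicate t x ≢ r ++ y ∷ c
  replicate≢++∷ (suc t) []      c x≢y eq = x≢y (proj₁ (∷-injective eq))
  replicate≢++∷ (suc t) (_ ∷ r) c x≢y eq = replicate≢++∷ t r c x≢y (∷-injectiveʳ eq)

  drop-replicate-++ : ∀ t (x : A) xs → drop t (replicate t x ++ xs) ≡ xs
  drop-replicate-++ zero    x xs = refl
  drop-replicate-++ (suc t) x xs = drop-replicate-++ t x xs

module _ {A : Set} {q : ℕ} where

  _[_]≔_ : Vector A q → Fin q → A → Vector A q
  xs [ i ]≔ y = updateAt xs i (const y)

  []≔-pointwise : (R : A → A → Set) {xs ys : Vector A q} (i : Fin q) {y : A} →
    (∀ j → R (xs j) (ys j)) → R (xs i) y → ∀ j → R (xs j) ((ys [ i ]≔ y) j)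
  []≔-pointwise R {xs} {ys} i {y} xs~ys xsᵢ~y j with j Fin.≟ i
  ... | yes refl = subst (R (xs j)) (sym (updateAt-updates j ys)) xsᵢ~y
  ... | no j≢i   = subst (R (xs j)) (sym (updateAt-minimal j i ys j≢i)) (xs~ys j)

module _ {m : ℕ} where

  digits : ∀ r → Fin (m ^ r) → List (Fin m)
  digits zero    _ = []
  digits (suc r) x = proj₁ (remQuot {m} (m ^ r) x) ∷ digits r (proj₂ (remQuot {m} (m ^ r) x))

  length-digits : ∀ r x → length (digits r x) ≡ r
  length-digits zero    _ = refl
  length-digits (suc r) x = cong suc (length-digits r _)

  undigits : ∀ r (xs : List (Fin m)) → length xs ≡ r → Fin (m ^ r)
  undigits zero    _        _  = zero
  undigits (suc r) (i ∷ xs) eq = combine i (undigits r xs (suc-injective eq))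

  digits-undigits : ∀ r xs (eq : length xs ≡ r) → digits r (undigits r xs eq) ≡ xs
  digits-undigits zero    []       _  = refl
  digits-undigits (suc r) (i ∷ xs) eq =
    trans (cong (λ (j , y) → j ∷ digits r y) (Fin.remQuot-combine {m} {m ^ r} i _))
          (cong (i ∷_) (digits-undigits r xs _))

  digits-injective : ∀ r → Injective _≡_ _≡_ (digits r)
  digits-injective zero    {zero} {zero} _ = refl
  digits-injective (suc r) {x} {y} eq with ∷-injective eq
  ... | head≡ , tail≡ = begin
    x                                 ≡⟨ Fin.combine-remQuot {m} (m ^ r) x ⟨
    uncurry combine (remQuot {m} _ x) ≡⟨ cong (uncurry combine) remQuot-x≡remQuot-y ⟩
    uncurry combine (remQuot {m} _ y) ≡⟨ Fin.combine-remQuot {m} (m ^ r) y ⟩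
    y                                 ∎
    where
    open ≡-Reasoning
    remQuot-x≡remQuot-y : remQuot {m} (m ^ r) x ≡ remQuot (m ^ r) y
    remQuot-x≡remQuot-y = cong₂ _,_ head≡ (digits-injective r tail≡)

module _ {m d : ℕ} where

  private
    T : Graph
    T = PerfectTree m d
    Vertex : Set
    Vertex = TreeVertex m d

  vertex-≡ : {u v : Vertex} → proj₁ u ≡ proj₁ v → u ≡ v
  vertex-≡ {xs , h} {.xs , h′} refl = cong (xs ,_) (≤-irrelevant h h′)

  _≟ᵛ_ : DecidableEquality Vertex
  u ≟ᵛ v with ≡-dec Fin._≟_ (proj₁ u) (proj₁ v)
  ... | yes eq = yes (vertex-≡ eq)
  ... | no neq = no (λ eq → neq (cong proj₁ eq))

  PerfectTree-sym : Symmetric (Adj T)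
  PerfectTree-sym (inj₁ child) = inj₂ child
  PerfectTree-sym (inj₂ child) = inj₁ child

  to-ancestor : ∀ t xs (h : length xs ≤ d) (h′ : length (drop t xs) ≤ d) →
                InNbhd T t (xs , h) (drop t xs , h′)
  to-ancestor zero    xs       h h′ = InNbhd-reflexive (vertex-≡ refl)
  to-ancestor (suc t) []       h h′ = InNbhd-reflexive (vertex-≡ refl)
  to-ancestor (suc t) (i ∷ xs) h h′ with to-ancestor t xs (≤-trans (n≤1+n _) h) h′
  ... | a , a≤t , p = suc a , s≤s a≤t , cons (inj₂ (i , refl)) p

  ViaCommonAncestor-step : ∀ {t u w ys} → Adj T u w →
    ViaCommonAncestor t (proj₁ w) ys → ViaCommonAncestor (suc t) (proj₁ u) ys
  ViaCommonAncestor-step {u = u} (inj₁ (i , w≡i∷u)) (([] , p′ , s) , w≡s , ys≡ , ≤t) =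
    ([] , p′ ++ i ∷ [] , proj₁ u) , refl , ys≡′ , ≤suc-t
    where
    ys≡′ : _ ≡ (p′ ++ i ∷ []) ++ proj₁ u
    ys≡′ = begin
      _                        ≡⟨ ys≡ ⟩
      p′ ++ s                  ≡⟨ cong (p′ ++_) (trans (sym w≡s) w≡i∷u) ⟩
      p′ ++ i ∷ proj₁ u        ≡⟨ ++-assoc p′ (i ∷ []) (proj₁ u) ⟨
      (p′ ++ i ∷ []) ++ proj₁ u ∎
      where open ≡-Reasoning
    ≤suc-t : length (p′ ++ i ∷ []) ≤ suc _
    ≤suc-t = begin
      length (p′ ++ i ∷ [])  ≡⟨ length-++ p′ ⟩
      length p′ + 1          ≡⟨ +-comm (length p′) 1 ⟩
      suc (length p′)        ≤⟨ s≤s ≤t ⟩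
      suc _                  ∎
      where open ≤-Reasoning
  ViaCommonAncestor-step (inj₁ (i , w≡i∷u)) ((_ ∷ p , p′ , s) , w≡ , ys≡ , ≤t) =
    (p , p′ , s) , ∷-injectiveʳ (trans (sym w≡i∷u) w≡) , ys≡ , m≤n⇒m≤1+n (≤-trans (n≤1+n _) ≤t)
  ViaCommonAncestor-step (inj₂ (i , u≡i∷w)) ((p , p′ , s) , w≡ , ys≡ , ≤t) =
    (i ∷ p , p′ , s) , trans u≡i∷w (cong (i ∷_) w≡) , ys≡ , s≤s ≤t

  walk⇒ViaCommonAncestor : ∀ {u v t} → Walk T u v t → ViaCommonAncestor t (proj₁ u) (proj₁ v)
  walk⇒ViaCommonAncestor {u} nil = ([] , [] , proj₁ u) , refl , refl , z≤n
  walk⇒ViaCommonAncestor {u} (cons {w = w} e p) =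
    ViaCommonAncestor-step {u = u} {w = w} e (walk⇒ViaCommonAncestor p)

  InNbhd⇒ViaCommonAncestor : ∀ {k u v} → InNbhd T k u v → ViaCommonAncestor k (proj₁ u) (proj₁ v)
  InNbhd⇒ViaCommonAncestor (a , a≤k , p) = ViaCommonAncestor-mono a≤k (walk⇒ViaCommonAncestor p)

module UpperBound (m n k : ℕ) (n+n≤k : n + n ≤ k) where

  private
    d q : ℕ
    d = n + k
    q = 1 + suc m ^ n
    T : Graph
    T = PerfectTree (suc m) d
    Vertex : Set
    Vertex = TreeVertex (suc m) d
    InNbhd-symᵀ : ∀ {t u v} → InNbhd T t u v → InNbhd T t v u
    InNbhd-symᵀ = InNbhd-sym {T} (λ {x} {y} → PerfectTree-sym {suc m} {d} {x} {y})

  AtLevel : Vertex → Set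
  AtLevel v = length (proj₁ v) ≡ n

  root : Vertex
  root = [] , z≤n

  level-to-root : ∀ {v} → AtLevel v → InNbhd T n v root
  level-to-root {xs , h} |xs|≡n =
    subst (InNbhd T n (xs , h)) (vertex-≡ (drop-all n xs (≤-reflexive |xs|≡n)))
          (to-ancestor n xs h (≤-trans (≤-reflexive (length-drop n xs)) (≤-trans (m∸n≤m _ n) h)))

  level-within-k : ∀ {a b} → AtLevel a → AtLevel b → InNbhd T k a b
  level-within-k a∈ b∈ =
    InNbhd-mono n+n≤k (InNbhd-trans (level-to-root a∈) (InNbhd-symᵀ (level-to-root b∈)))

  near-level : (v : Vertex) → ∃ λ c → AtLevel c × InNbhd T k v c
  near-level (xs , h) with n ≤? length xs
  ... | yes n≤|xs| = (drop t xs , hc) , |c|≡n , InNbhd-mono t≤k (to-ancestor t xs h hc)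
    where
    t = length xs ∸ n
    |c|≡n : length (drop t xs) ≡ n
    |c|≡n = trans (length-drop t xs) (m∸[m∸n]≡n n≤|xs|)
    hc : length (drop t xs) ≤ d
    hc = subst (_≤ d) (sym |c|≡n) (m≤m+n n k)
    t≤k : t ≤ k
    t≤k = subst (t ≤_) (m+n∸m≡n n k) (∸-monoˡ-≤ n h)
  ... | no n≰|xs| = (ys , hc) , |c|≡n , InNbhd-mono t≤k (InNbhd-symᵀ up)
    where
    t = n ∸ length xs
    ys = replicate t zero ++ xs
    |c|≡n : length ys ≡ n
    |c|≡n = trans (length-++ (replicate t zero))
              (trans (cong (_+ length xs) (length-replicate t)) (m∸n+n≡m (≰⇒≥ n≰|xs|)))
    hc : length ys ≤ d
    hc = subst (_≤ d) (sym |c|≡n) (m≤m+n n k)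
    t≤k : t ≤ k
    t≤k = ≤-trans (m∸n≤m n (length xs)) (≤-trans (m≤m+n n n) n+n≤k)
    up : InNbhd T t (ys , hc) (xs , h)
    up = subst (InNbhd T t (ys , hc)) (vertex-≡ (drop-replicate-++ t zero xs))
               (to-ancestor t ys hc (subst (λ zs → length zs ≤ d) (sym (drop-replicate-++ t zero xs)) h))

  FreeGuard : Multiset T q → Fin q → Set
  FreeGuard D j = ∀ w → AtLevel w → ∃ λ i → i ≢ j × D i ≡ w

  initial : Multiset T q
  initial zero    = root
  initial (suc y) = digits n y , subst (_≤ d) (sym (length-digits n y)) (m≤m+n n k)

  initial-free : FreeGuard initial zero
  initial-free (xs , _) |xs|≡n =
    suc (undigits n xs |xs|≡n) , (λ ()) , vertex-≡ (digits-undigits n xs |xs|≡n)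

  free-dominates : ∀ {D j} → FreeGuard D j → IsDistDomSet T k D
  free-dominates {D} occupied v with near-level v
  ... | c , c∈ , v~c with occupied c c∈
  ... | i , _ , Dᵢ≡c = inj₂ (i , subst (λ u → InNbhd T k u v) (sym Dᵢ≡c) (InNbhd-symᵀ v~c))

  free-respond : ∀ {D j} → FreeGuard D j → (v : Vertex) →
    ∃ λ D′ → ∃ (FreeGuard D′) × _∈ₘ_ {T} v D′ × Transforms T k D D′
  free-respond {D} {j} occupied v with near-level (D j) | near-level v
  ... | a , a∈ , Dⱼ~a | b , b∈ , v~b with occupied a a∈ | occupied b b∈
  ... | ia , ia≢j , D-ia≡a | ib , ib≢j , D-ib≡b =
    D′ , (ib , free′) , (ib , D′-ib≡v) , ↔-id (Fin q) , moves
    where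
    D′ : Multiset T q
    D′ = ((D [ ia ]≔ b) [ ib ]≔ v) [ j ]≔ a

    moves : ∀ i → InNbhd T k (D i) (D′ i)
    moves = []≔-pointwise R j ([]≔-pointwise R ib ([]≔-pointwise R ia stay a~b) b~v) Dⱼ~a
      where
      R : Vertex → Vertex → Set
      R = InNbhd T k
      stay : ∀ i → R (D i) (D i)
      stay _ = InNbhd-reflexive refl
      a~b : R (D ia) b
      a~b = subst (λ u → R u b) (sym D-ia≡a) (level-within-k a∈ b∈)
      b~v : R (D ib) v
      b~v = subst (λ u → R u v) (sym D-ib≡b) (InNbhd-symᵀ v~b)

    D′-ib≡v : D′ ib ≡ v
    D′-ib≡v = trans (updateAt-minimal ib j _ ib≢j) (updateAt-updates ib _)

    free′ : FreeGuard D′ ib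
    free′ w w∈ with w ≟ᵛ a
    ... | yes refl = j , (λ j≡ib → ib≢j (sym j≡ib)) , updateAt-updates j _
    ... | no w≢a with w ≟ᵛ b
    ... | yes refl = ia , ia≢ib , D′-ia≡b
      where
      ia≢ib : ia ≢ ib
      ia≢ib refl = w≢a (trans (sym D-ib≡b) D-ia≡a)
      D′-ia≡b : D′ ia ≡ b
      D′-ia≡b = trans (updateAt-minimal ia j _ ia≢j)
                  (trans (updateAt-minimal ia ib _ ia≢ib) (updateAt-updates ia D))
    ... | no w≢b with occupied w w∈
    ... | i , i≢j , Dᵢ≡w = i , i≢ib , D′ᵢ≡w
      where
      i≢ib : i ≢ ib
      i≢ib refl = w≢b (trans (sym Dᵢ≡w) D-ib≡b)
      i≢ia : i ≢ ia
      i≢ia refl = w≢a (trans (sym Dᵢ≡w) D-ia≡a)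
      D′ᵢ≡w : D′ i ≡ w
      D′ᵢ≡w = trans (updateAt-minimal i j _ i≢j)
                (trans (updateAt-minimal i ib _ i≢ib) (trans (updateAt-minimal i ia D i≢ia) Dᵢ≡w))

  upper-bound : EternalFamily T k q
  upper-bound = record
    { member    = λ D → ∃ (FreeGuard D)
    ; nonempty  = initial , zero , initial-free
    ; dominates = λ D (_ , occupied) → free-dominates occupied
    ; respond   = λ D (_ , occupied) → free-respond occupied
    }

module LowerBound (m n k : ℕ) where

  private
    M d : ℕ
    M = suc (suc m)
    d = n + suc k
    T : Graph
    T = PerfectTree M d
    0F 1F : Fin M
    0F = zero
    1F = suc zero
    0F≢1F : 0F ≢ 1F
    0F≢1F ()

  leftmost : List (Fin M)
  leftmost = replicate d 0F

  witness : Fin (M ^ n) → List (Fin M)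
  witness y = replicate k 0F ++ 1F ∷ digits n y

  length-witness : ∀ y → length (witness y) ≡ d
  length-witness y = begin
    length (witness y)                                ≡⟨ length-++ (replicate k 0F) ⟩
    length (replicate k 0F) + suc (length (digits n y)) ≡⟨ cong₂ (λ a b → a + suc b)
                                                             (length-replicate k) (length-digits n y) ⟩
    k + suc n                                         ≡⟨ +-comm k (suc n) ⟩
    suc (n + k)                                       ≡⟨ +-suc n k ⟨
    n + suc k                                         ∎
    where open ≡-Reasoning

  witness-far : ∀ y → ¬ ViaCommonAncestor (suc k) leftmost (witness y)
  witness-far y ((p , p′ , s) , ℓ≡p++s , w≡p′++s , ≤suc-k) =
    absurd (++-≡-++⇒suffix p′ (replicate k 0F) (sym w≡p′++s) |p′|≤k)
    where
    |p|≡|p′| : length p ≡ length p′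
    |p|≡|p′| = +-cancelʳ-≡ (length s) (length p) (length p′) (begin
      length p + length s   ≡⟨ length-++ p ⟨
      length (p ++ s)       ≡⟨ cong length ℓ≡p++s ⟨
      length leftmost       ≡⟨ length-replicate d ⟩
      d                     ≡⟨ length-witness y ⟨
      length (witness y)    ≡⟨ cong length w≡p′++s ⟩
      length (p′ ++ s)      ≡⟨ length-++ p′ ⟩
      length p′ + length s  ∎)
      where open ≡-Reasoning
    |p′|≤k : length p′ ≤ length (replicate k 0F)
    |p′|≤k = subst (length p′ ≤_) (sym (length-replicate k))
               (half-≤ (length p′) k (subst (λ a → a + length p′ ≤ suc k) |p|≡|p′| ≤suc-k))
    absurd : ¬ (∃ λ r → s ≡ r ++ 1F ∷ digits n y)
    absurd (r , s≡r++1∷y) = replicate≢++∷ d (p ++ r) (digits n y) 0F≢1F (begin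
      leftmost                        ≡⟨ ℓ≡p++s ⟩
      p ++ s                          ≡⟨ cong (p ++_) s≡r++1∷y ⟩
      p ++ r ++ 1F ∷ digits n y       ≡⟨ ++-assoc p r _ ⟨
      (p ++ r) ++ 1F ∷ digits n y     ∎)
      where open ≡-Reasoning

  witness-suffix : ∀ {xs} y → ViaCommonAncestor (suc k) xs (witness y) →
                   ∃ λ u → xs ≡ u ++ digits n y
  witness-suffix y ((p , p′ , s) , xs≡p++s , w≡p′++s , ≤suc-k) =
    extend (++-≡-++⇒suffix p′ prefix w≡prefix++y |p′|≤|prefix|)
    where
    prefix : List (Fin M)
    prefix = replicate k 0F ++ 1F ∷ []
    w≡prefix++y : p′ ++ s ≡ prefix ++ digits n y
    w≡prefix++y = trans (sym w≡p′++s) (sym (++-assoc (replicate k 0F) _ _))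
    |p′|≤|prefix| : length p′ ≤ length prefix
    |p′|≤|prefix| = begin
      length p′                       ≤⟨ m≤n+m _ (length p) ⟩
      length p + length p′            ≤⟨ ≤suc-k ⟩
      suc k                           ≡⟨ +-comm 1 k ⟩
      k + 1                           ≡⟨ cong (_+ 1) (length-replicate k) ⟨
      length (replicate k 0F) + 1     ≡⟨ length-++ (replicate k 0F) ⟨
      length prefix                   ∎
      where open ≤-Reasoning
    extend : (∃ λ r → s ≡ r ++ digits n y) → ∃ λ u → _ ≡ u ++ digits n y
    extend (r , s≡r++y) = p ++ r , trans xs≡p++s (trans (cong (p ++_) s≡r++y) (sym (++-assoc p r _)))

  witness-separated : ∀ {xs} y y′ → ViaCommonAncestor (suc k) xs (witness y) →
                      ViaCommonAncestor (suc k) xs (witness y′) → y ≡ y′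
  witness-separated y y′ xs~y xs~y′ with witness-suffix y xs~y | witness-suffix y′ xs~y′
  ... | u , xs≡u++y | u′ , xs≡u′++y′ =
    digits-injective n (++-cancelˡ-length u u′ |y|≡|y′| (trans (sym xs≡u++y) xs≡u′++y′))
    where
    |y|≡|y′| : length (digits n y) ≡ length (digits n y′)
    |y|≡|y′| = trans (length-digits n y) (sym (length-digits n y′))

  guard-at-leftmost⇒< : ∀ {q} (D : Multiset T q) j → proj₁ (D j) ≡ leftmost →
                         IsDistDomSet T (suc k) D → M ^ n < q
  guard-at-leftmost⇒< {q} D j Dⱼ≡leftmost dominating =
    injective-avoiding⇒< guard j j-far guard-injective
    where
    guarding : ∀ y → ∃ λ i → ViaCommonAncestor (suc k) (proj₁ (D i)) (witness y)
    guarding y with dominating (witness y , ≤-reflexive (length-witness y))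
    ... | inj₁ (i , Dᵢ≡w) = i , InNbhd⇒ViaCommonAncestor (InNbhd-reflexive {T} Dᵢ≡w)
    ... | inj₂ (i , Dᵢ~w) = i , InNbhd⇒ViaCommonAncestor Dᵢ~w
    guard : Fin (M ^ n) → Fin q
    guard y = proj₁ (guarding y)
    guarded : ∀ y → ViaCommonAncestor (suc k) (proj₁ (D (guard y))) (witness y)
    guarded y = proj₂ (guarding y)
    guard-injective : Injective _≡_ _≡_ guard
    guard-injective {y} {y′} eq = witness-separated y y′ (guarded y)
      (subst (λ i → ViaCommonAncestor (suc k) (proj₁ (D i)) (witness y′)) (sym eq) (guarded y′))
    j-far : ∀ y → j ≢ guard y
    j-far y j≡guard = witness-far y (subst (λ xs → ViaCommonAncestor (suc k) xs (witness y))
                                           D-guard≡leftmost (guarded y))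
      where
      D-guard≡leftmost : proj₁ (D (guard y)) ≡ leftmost
      D-guard≡leftmost = trans (cong (proj₁ ∘ D) (sym j≡guard)) Dⱼ≡leftmost

  lower-bound : ∀ q → EternalFamily T (suc k) q → 1 + M ^ n ≤ q
  lower-bound q family with EternalFamily.nonempty family
  ... | D , D∈ with EternalFamily.respond family D D∈ (leftmost , ≤-reflexive (length-replicate d))
  ... | D′ , D′∈ , (j , Dⱼ≡leftmost) , _ =
    guard-at-leftmost⇒< D′ j (cong proj₁ Dⱼ≡leftmost) (EternalFamily.dominates family D′ D′∈)

theorem5 : (m k d : ℕ) → 2 ≤ m → 2 ≤ k → k ≤ d → 2 * d ≤ 3 * k →
    EternalDomNumberIs (PerfectTree m d) k (1 + m ^ (d ∸ k))
theorem5 (suc (suc m)) (suc k) d (s≤s (s≤s z≤n)) (s≤s _) k≤d 2d≤3k =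
  subst (λ e → EternalDomNumberIs (PerfectTree (suc (suc m)) e) (suc k) (1 + suc (suc m) ^ n))
        (m∸n+n≡m k≤d)
        (UpperBound.upper-bound (suc m) n (suc k) (excess-double-≤ (suc k) d k≤d 2d≤3k) ,
         LowerBound.lower-bound m n k)
  where
  n : ℕ
  n = d ∸ suc k
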